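{- Let $G$ and $H$ be connected simple graphs on at least two vertices with $\Delta(G)\geq\Delta(H)$, and let $l\geq 2$ be an integer. (1) If $\chi''_a(G)\leq\Delta(G)+3$ and $\chi''(H)\leq\Delta(H)+2$, then $\chi''_a(G\circ^l H)\leq\Delta(G\circ^l H)+3$. (2) If $\chi''_a(G)\leq\Delta(G)+3$ and $\chi''_a(H)\leq\Delta(H)+3$, then $\chi''_a(G\circ^l H)\leq\Delta(G\circ^l H)+3$. (3) If $G$ and $H$ are bipartite, then $\chi''_a(G\circ^l H)\leq\Delta(G\circ^l H)+2$.
   Context: All graphs are finite and simple; $\Delta(\cdot)$ denotes maximum degree and $[k]=\{1,\ldots,k\}$. A proper total $k$-coloring of $G=(V,E)$ is a map $f:V\cup E\to[k]$ such that adjacent vertices get different colors, adjacent edges get different colors, and each edge gets a color different from the colors of its endvertices; $\chi''(G)$ is the least such $k$. The color set of $v$ is $C_f(v)=\{f(v)\}\cup\{f(vu): vu\in E\}$. An adjacent vertex distinguishing (avd) total $k$-coloring is a proper total $k$-coloring with $C_f(u)\neq C_f(v)$ for every edge $uv$; $\chi''_a(G)$ is the least such $k$. The corona $G\circ H$ is obtained from one copy of $G$ and $|V(G)|$ disjoint copies of $H$, one for each vertex $v$ of $G$, by joining each vertex $v$ of $G$ to every vertex of its copy of $H$. The $l$-corona is defined by $G\circ^1 H=G\circ H$ and $G\circ^l H=(G\circ^{l-1}H)\circ H$ for $l\geq 2$. -}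

module Defs where

open import Data.Bool using (Bool; true; false; _∧_; if_then_else_)
open import Data.Bool.Properties using (∧-comm)
open import Data.Nat using (ℕ; zero; suc; _+_; _*_; _≤_; _⊔_)
open import Data.Fin using (Fin; splitAt; quotient; remainder; _≟_)
open import Data.List using (List; map; foldr; allFin)
open import Data.Nat.ListAction using (sum)
open import Data.Sum using (_⊎_; inj₁; inj₂)
open import Data.Product using (Σ; ∃; _×_; _,_)
open import Relation.Nullary using (¬_; yes; no)
open import Relation.Nullary.Decidable using (⌊_⌋)
open import Relation.Binary.PropositionalEquality using (_≡_; _≢_; refl; sym; trans; cong)

record Graph : Set where
  field
    n      : ℕ
    adj    : Fin n → Fin n → Bool
    adj-sym    : ∀ u v → adj u v ≡ adj v u
    adj-irrefl : ∀ v → adj v v ≡ false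

open Graph public

_∋_~_ : (G : Graph) → Fin (n G) → Fin (n G) → Set
G ∋ u ~ v = adj G u v ≡ true

deg : (G : Graph) → Fin (n G) → ℕ
deg G v = sum (map (λ u → if adj G v u then 1 else 0) (allFin (n G)))

Δ : Graph → ℕ
Δ G = foldr _⊔_ 0 (map (deg G) (allFin (n G)))

data Reach (G : Graph) : Fin (n G) → Fin (n G) → Set where
  here : ∀ {v} → Reach G v v
  step : ∀ {u w v} → G ∋ u ~ w → Reach G w v → Reach G u v

Connected : Graph → Set
Connected G = ∀ u v → Reach G u v

Bipartite : Graph → Set
Bipartite G = Σ (Fin (n G) → Bool) λ side → ∀ u v → G ∋ u ~ v → side u ≢ side v

-- Total colorings.  A total k-coloring assigns colors in Fin k (= [k])
-- to vertices (vcol) and to edges (ecol u v for the edge uv; symmetric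
-- on edges; values on non-edges are irrelevant).

record TotalColoring (G : Graph) (k : ℕ) : Set where
  field
    vcol : Fin (n G) → Fin k
    ecol : Fin (n G) → Fin (n G) → Fin k
    ecol-sym : ∀ u v → G ∋ u ~ v → ecol u v ≡ ecol v u
    vv : ∀ u v → G ∋ u ~ v → vcol u ≢ vcol v
    ee : ∀ u v w → G ∋ u ~ v → G ∋ u ~ w → v ≢ w → ecol u v ≢ ecol u w
    ve : ∀ u v → G ∋ u ~ v → ecol u v ≢ vcol u × ecol u v ≢ vcol v

open TotalColoring public

_∈C[_]_ : ∀ {G k} → Fin k → TotalColoring G k → Fin (n G) → Set
_∈C[_]_ {G} i f v = (vcol f v ≡ i) ⊎ (∃ λ u → (G ∋ v ~ u) × (ecol f v u ≡ i))

record AVDTotalColoring (G : Graph) (k : ℕ) : Set where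
  field
    coloring : TotalColoring G k
    distinguishing : ∀ u v → G ∋ u ~ v →
      ¬ (∀ (i : Fin k) → (i ∈C[ coloring ] u → i ∈C[ coloring ] v)
                       × (i ∈C[ coloring ] v → i ∈C[ coloring ] u))

χ''≤ : Graph → ℕ → Set
χ''≤ G k = ∃ λ k' → k' ≤ k × TotalColoring G k'

χ''a≤ : Graph → ℕ → Set
χ''a≤ G k = ∃ λ k' → k' ≤ k × AVDTotalColoring G k'

-- Corona G ∘ H.  Vertices: Fin (nG + nG * nH); the first nG are the
-- vertices of G, a vertex p of the second block is vertex
-- (remainder p) of the copy of H attached to vertex (quotient p) of G.

private
  eqb : ∀ {m} → Fin m → Fin m → Bool
  eqb a b = ⌊ a ≟ b ⌋

  eqb-sym : ∀ {m} (a b : Fin m) → eqb a b ≡ eqb b a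
  eqb-sym a b with a ≟ b | b ≟ a
  ... | yes _ | yes _ = refl
  ... | no _  | no _  = refl
  ... | yes p | no q  with q (sym p)
  ... | ()
  eqb-sym a b | no q | yes p with q (sym p)
  ... | ()

  eqb-refl : ∀ {m} (a : Fin m) → eqb a a ≡ true
  eqb-refl a with a ≟ a
  ... | yes _ = refl
  ... | no q with q refl
  ... | ()

module _ (G H : Graph) where
  private
    N = n G
    M = n H

    qu : Fin (N * M) → Fin N
    qu p = quotient {N} M p
    re : Fin (N * M) → Fin M
    re p = remainder {N} M p

    adj' : Fin N ⊎ Fin (N * M) → Fin N ⊎ Fin (N * M) → Bool
    adj' (inj₁ a) (inj₁ b) = adj G a b
    adj' (inj₁ a) (inj₂ p) = eqb a (qu p)
    adj' (inj₂ p) (inj₁ a) = eqb a (qu p)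
    adj' (inj₂ p) (inj₂ q) = eqb (qu p) (qu q)
                             ∧ adj H (re p) (re q)

    adj'-sym : ∀ x y → adj' x y ≡ adj' y x
    adj'-sym (inj₁ a) (inj₁ b) = adj-sym G a b
    adj'-sym (inj₁ a) (inj₂ p) = refl
    adj'-sym (inj₂ p) (inj₁ a) = refl
    adj'-sym (inj₂ p) (inj₂ q) =
      trans (cong (_∧ adj H (re p) (re q))
                  (eqb-sym (qu p) (qu q)))
            (cong (eqb (qu q) (qu p) ∧_)
                  (adj-sym H (re p) (re q)))

    adj'-irrefl : ∀ x → adj' x x ≡ false
    adj'-irrefl (inj₁ a) = adj-irrefl G a
    adj'-irrefl (inj₂ p) rewrite eqb-refl (qu p) =
      adj-irrefl H (re p)

  corona : Graph
  corona = record
    { n = N + N * M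
    ; adj = λ x y → adj' (splitAt N x) (splitAt N y)
    ; adj-sym = λ x y → adj'-sym (splitAt N x) (splitAt N y)
    ; adj-irrefl = λ x → adj'-irrefl (splitAt N x)
    }

lcorona : Graph → Graph → ℕ → Graph
lcorona G H zero    = G
lcorona G H (suc l) = corona (lcorona G H l) H

-- A corona K ∘ H inherits an AVD total coloring from an AVD total k-coloring of K and a total
-- k-coloring of H, using k + |H| colors: keep all old colors, give the edge from a vertex a of K to
-- the copy of vertex h of H the new color h, and recolor a copy of h by a new color whenever its
-- H-color clashes with the color of a. The new colors tell adjacent vertices apart. Iterating
-- gives k + l|H| colors for G ∘^l H, while Δ(G ∘^l H) ≥ Δ(G) + l|H|. For bipartite graphs,
-- König's theorem gives a proper edge coloring with Δ colors, and two more colors for the two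
-- sides make it an AVD total coloring with Δ + 2 colors.
module Submission where

open import Defs
open import Algebra.Properties.CommutativeMonoid.Sum as Sum using ()
open import Data.Bool using (Bool; true; false; not; _∧_; _xor_; if_then_else_)
open import Data.Bool.Properties using (not-distribˡ-xor; not-¬; ¬-not; not-injective; not-involutive; ∧-conicalˡ; ∧-conicalʳ)
open import Data.Empty using (⊥; ⊥-elim)
open import Data.Maybe as Maybe using (Maybe; just; nothing; _>>=_)
import Data.Fin.Permutation.Components as PC
open import Data.Maybe.Properties using (≡-dec; just-injective; map-id; map-injective; map-just)
open import Data.Fin using (Fin; zero; suc; splitAt; join; inject≤; toℕ; fromℕ<; quotient; remainder; combine; _↑ˡ_; _↑ʳ_; punchIn; punchOut)
open import Data.Fin.Properties using (_≟_; splitAt-↑ˡ; splitAt-↑ʳ; remQuot-combine; combine-injectiveʳ; combine-remQuot; join-splitAt; splitAt-join; ↑ˡ-injective; ↑ʳ-injective; punchInᵢ≢i; inject≤-injective; injective⇒≤; toℕ<n; toℕ-injective; toℕ-fromℕ<; punchOut-injective; punchIn-punchOut; suc-injective; all?; any?; ¬∀⟶∃¬)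
open import Data.List using (List; []; _∷_; map; foldr; allFin; tabulate; cartesianProduct)
open import Data.List.Membership.Propositional using (_∈_)
open import Data.List.Membership.Propositional.Properties using (∈-allFin; ∈-cartesianProduct⁺; ∈-map⁺; ∈-map⁻; foldr-selective)
open import Data.List.Properties using (map-tabulate)
open import Data.List.Relation.Unary.Any using (here; there)
open import Data.Nat using (ℕ; zero; suc; _+_; _*_; _≤_; _<_; _⊔_; z≤n; s≤s; s≤s⁻¹)
open import Data.Nat.ListAction as List using ()
open import Data.Nat.Properties using (module ≤-Reasoning; +-0-commutativeMonoid; ≤-refl; ≤-trans; ≤-reflexive; m≤m⊔n; m≤n⊔m; ⊔-sel; +-monoʳ-≤; +-monoˡ-≤; +-identityʳ; +-assoc; +-comm; m≤m+n; 1+n≰n; m≤n⇒m<n∨m≡n; <-cmp; +-mono-≤; n≤1+n)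
open import Data.Product using (∃; _×_; _,_; proj₁; proj₂)
open import Data.Sum using (_⊎_; inj₁; inj₂)
open import Function using (_∘_; id; case_of_)
open import Relation.Nullary using (¬_; yes; no; Dec)
open import Relation.Nullary.Decidable using (⌊_⌋; _×-dec_; _⊎-dec_; isYes≗does; dec-true; dec-false)
open import Relation.Binary.PropositionalEquality
open import Relation.Binary.Definitions using (tri<; tri≈; tri>)

open Sum +-0-commutativeMonoid using (sum; sum-cong-≗; sum-remove)

indicator : Bool → ℕ
indicator b = if b then 1 else 0

count : ∀ {m} → (Fin m → Bool) → ℕ
count b = sum (indicator ∘ b)

sum-↑ : ∀ a {b} (f : Fin (a + b) → ℕ) → sum f ≡ sum (f ∘ (_↑ˡ b)) + sum (f ∘ (a ↑ʳ_))
sum-↑ zero    f = refl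
sum-↑ (suc a) f = trans (cong (f zero +_) (sum-↑ a (f ∘ suc))) (sym (+-assoc (f zero) _ _))

injective⇒≤count : ∀ {m N} (b : Fin N → Bool) (F : Fin m → Fin N) →
  (∀ {i j} → F i ≡ F j → i ≡ j) → (∀ i → b (F i) ≡ true) → m ≤ count b
injective⇒≤count {zero}          b F F-inj true-on-F = z≤n
injective⇒≤count {suc m} {zero}  b F F-inj true-on-F with F zero
... | ()
injective⇒≤count {suc m} {suc N} b F F-inj true-on-F =
  begin
    suc m                                                   ≤⟨ s≤s (injective⇒≤count (b ∘ punchIn (F zero)) F′ F′-inj true-on-F′) ⟩
    1 + count (b ∘ punchIn (F zero))                        ≡⟨ cong (λ c → indicator c + count (b ∘ punchIn (F zero))) (true-on-F zero) ⟨
    indicator (b (F zero)) + count (b ∘ punchIn (F zero))   ≡⟨ sum-remove (indicator ∘ b) ⟨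
    count b                                                 ∎
  where
  open ≤-Reasoning
  F-suc≢F-zero : ∀ i → F zero ≢ F (suc i)
  F-suc≢F-zero i e with F-inj e
  ... | ()
  F′ : Fin m → Fin N
  F′ i = punchOut (F-suc≢F-zero i)
  F′-inj : ∀ {i j} → F′ i ≡ F′ j → i ≡ j
  F′-inj e = suc-injective (F-inj (punchOut-injective (F-suc≢F-zero _) (F-suc≢F-zero _) e))
  true-on-F′ : ∀ i → b (punchIn (F zero) (F′ i)) ≡ true
  true-on-F′ i = trans (cong b (punchIn-punchOut (F-suc≢F-zero i))) (true-on-F (suc i))

sum-tabulate : ∀ {m} (f : Fin m → ℕ) → List.sum (tabulate f) ≡ sum f
sum-tabulate {zero}  f = refl
sum-tabulate {suc m} f = cong (f zero +_) (sum-tabulate (f ∘ suc))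

deg≡count : ∀ G v → deg G v ≡ count (adj G v)
deg≡count G v = trans (cong List.sum (map-tabulate id (indicator ∘ adj G v))) (sum-tabulate (indicator ∘ adj G v))

∈⇒≤max : ∀ {x xs} → x ∈ xs → x ≤ foldr _⊔_ 0 xs
∈⇒≤max (here refl) = m≤m⊔n _ _
∈⇒≤max (there x∈xs) = ≤-trans (∈⇒≤max x∈xs) (m≤n⊔m _ _)

deg≤Δ : ∀ G v → deg G v ≤ Δ G
deg≤Δ G v = ∈⇒≤max (∈-map⁺ (deg G) (∈-allFin v))

Δ-attained : ∀ G → Fin (n G) → ∃ λ v → Δ G ≤ deg G v
Δ-attained G v₀ with foldr-selective ⊔-sel 0 (map (deg G) (allFin (n G)))
... | inj₁ Δ≡0  = v₀ , subst (_≤ deg G v₀) (sym Δ≡0) z≤n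
... | inj₂ Δ∈ds with ∈-map⁻ (deg G) Δ∈ds
...   | v , _ , Δ≡deg = v , ≤-reflexive Δ≡deg

≟-true : ∀ {m} {a b : Fin m} → a ≡ b → ⌊ a ≟ b ⌋ ≡ true
≟-true {a = a} {b} a≡b = trans (isYes≗does (a ≟ b)) (dec-true (a ≟ b) a≡b)

≟-sound : ∀ {m} {a b : Fin m} → ⌊ a ≟ b ⌋ ≡ true → a ≡ b
≟-sound {a = a} {b} e with a ≟ b | e
... | yes a≡b | _ = a≡b
... | no _    | ()

module CoronaCoordinates (K H : Graph) where

  Vertex : Set
  Vertex = Fin (n K) ⊎ Fin (n K * n H)

  block : Fin (n K * n H) → Fin (n K)
  block = quotient (n H)

  position : Fin (n K * n H) → Fin (n H)
  position = remainder {n K} (n H)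

  -- The adjacency of corona K H read through splitAt (n K); a leaf p is the vertex position p
  -- of the copy of H attached to block p.
  adjacent : Vertex → Vertex → Bool
  adjacent (inj₁ a) (inj₁ b) = adj K a b
  adjacent (inj₁ a) (inj₂ p) = ⌊ a ≟ block p ⌋
  adjacent (inj₂ p) (inj₁ a) = ⌊ a ≟ block p ⌋
  adjacent (inj₂ p) (inj₂ q) = ⌊ block p ≟ block q ⌋ ∧ adj H (position p) (position q)

  adj-corona : ∀ x y → adj (corona K H) x y ≡ adjacent (splitAt (n K) x) (splitAt (n K) y)
  adj-corona x y with splitAt (n K) x | splitAt (n K) y
  ... | inj₁ _ | inj₁ _ = refl
  ... | inj₁ _ | inj₂ _ = refl
  ... | inj₂ _ | inj₁ _ = refl
  ... | inj₂ _ | inj₂ _ = refl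

  block-combine : ∀ (a : Fin (n K)) (h : Fin (n H)) → block (combine a h) ≡ a
  block-combine a h = cong proj₁ (remQuot-combine {n K} {n H} a h)

  position-combine : ∀ (a : Fin (n K)) (h : Fin (n H)) → position (combine a h) ≡ h
  position-combine a h = cong proj₂ (remQuot-combine {n K} {n H} a h)

  deg-corona-base : ∀ a → deg K a + n H ≤ deg (corona K H) (a ↑ˡ (n K * n H))
  deg-corona-base a = begin
    deg K a + n H                                               ≡⟨ cong (_+ n H) (deg≡count K a) ⟩
    count (adj K a) + n H                                       ≤⟨ +-monoʳ-≤ (count (adj K a)) leaves ⟩
    count (adj K a) + count (λ p → ⌊ a ≟ block p ⌋)             ≡⟨ cong₂ _+_ base-part leaf-part ⟨
    sum (f ∘ (_↑ˡ (n K * n H))) + sum (f ∘ (n K ↑ʳ_))          ≡⟨ sum-↑ (n K) f ⟨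
    count (adj (corona K H) (a ↑ˡ (n K * n H)))                ≡⟨ deg≡count (corona K H) _ ⟨
    deg (corona K H) (a ↑ˡ (n K * n H))                        ∎
    where
    open ≤-Reasoning
    f : Fin (n K + n K * n H) → ℕ
    f = indicator ∘ adj (corona K H) (a ↑ˡ (n K * n H))
    row : ∀ y → f y ≡ indicator (adjacent (inj₁ a) (splitAt (n K) y))
    row y = cong indicator (trans (adj-corona _ y) (cong (λ z → adjacent z (splitAt (n K) y)) (splitAt-↑ˡ (n K) a _)))
    base-part : sum (f ∘ (_↑ˡ (n K * n H))) ≡ count (adj K a)
    base-part = sum-cong-≗ λ b → trans (row _) (cong (indicator ∘ adjacent (inj₁ a)) (splitAt-↑ˡ (n K) b _))
    leaf-part : sum (f ∘ (n K ↑ʳ_)) ≡ count (λ p → ⌊ a ≟ block p ⌋)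
    leaf-part = sum-cong-≗ λ p → trans (row _) (cong (indicator ∘ adjacent (inj₁ a)) (splitAt-↑ʳ (n K) _ p))
    leaves : n H ≤ count (λ p → ⌊ a ≟ block p ⌋)
    leaves = injective⇒≤count _ (combine {n K} {n H} a) (combine-injectiveʳ a _ a _)
               (λ h → ≟-true (sym (block-combine a h)))

  Δ-corona : Fin (n K) → Δ K + n H ≤ Δ (corona K H)
  Δ-corona a₀ with Δ-attained K a₀
  ... | a , Δ≤deg = ≤-trans (+-monoˡ-≤ (n H) Δ≤deg) (≤-trans (deg-corona-base a) (deg≤Δ (corona K H) _))

module _ (G H : Graph) (v : Fin (n G)) where

  lcorona-base : ∀ l → Fin (n (lcorona G H l))
  lcorona-base zero    = v
  lcorona-base (suc l) = lcorona-base l ↑ˡ _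

  Δ-lcorona : ∀ l → Δ G + l * n H ≤ Δ (lcorona G H l)
  Δ-lcorona zero    = ≤-reflexive (+-identityʳ (Δ G))
  Δ-lcorona (suc l) = begin
    Δ G + (n H + l * n H)        ≡⟨ cong (Δ G +_) (+-comm (n H) (l * n H)) ⟩
    Δ G + (l * n H + n H)        ≡⟨ +-assoc (Δ G) (l * n H) (n H) ⟨
    Δ G + l * n H + n H          ≤⟨ +-monoˡ-≤ (n H) (Δ-lcorona l) ⟩
    Δ (lcorona G H l) + n H      ≤⟨ CoronaCoordinates.Δ-corona (lcorona G H l) H (lcorona-base l) ⟩
    Δ (lcorona G H (suc l))      ∎
    where open ≤-Reasoning

module _ {G : Graph} {k k′ : ℕ} (φ : Fin k → Fin k′) (φ-injective : ∀ {a b} → φ a ≡ φ b → a ≡ b) where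

  mapTotalColoring : TotalColoring G k → TotalColoring G k′
  mapTotalColoring c = record
    { vcol     = φ ∘ vcol c
    ; ecol     = λ u v → φ (ecol c u v)
    ; ecol-sym = λ u v u~v → cong φ (ecol-sym c u v u~v)
    ; vv       = λ u v u~v → vv c u v u~v ∘ φ-injective
    ; ee       = λ u v w u~v u~w v≢w → ee c u v w u~v u~w v≢w ∘ φ-injective
    ; ve       = λ u v u~v → proj₁ (ve c u v u~v) ∘ φ-injective , proj₂ (ve c u v u~v) ∘ φ-injective
    }

  mapAVDTotalColoring : AVDTotalColoring G k → AVDTotalColoring G k′
  mapAVDTotalColoring a = record
    { coloring       = mapTotalColoring c
    ; distinguishing = λ u v u~v same → AVDTotalColoring.distinguishing a u v u~v
        λ i → preimage ∘ proj₁ (same (φ i)) ∘ image , preimage ∘ proj₂ (same (φ i)) ∘ image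
    }
    where
    c = AVDTotalColoring.coloring a
    image : ∀ {i x} → i ∈C[ c ] x → φ i ∈C[ mapTotalColoring c ] x
    image (inj₁ e)             = inj₁ (cong φ e)
    image (inj₂ (u , x~u , e)) = inj₂ (u , x~u , cong φ e)
    preimage : ∀ {i x} → φ i ∈C[ mapTotalColoring c ] x → i ∈C[ c ] x
    preimage (inj₁ e)             = inj₁ (φ-injective e)
    preimage (inj₂ (u , x~u , e)) = inj₂ (u , x~u , φ-injective e)

weakenTotalColoring : ∀ {G k k′} → k ≤ k′ → TotalColoring G k → TotalColoring G k′
weakenTotalColoring k≤k′ = mapTotalColoring (λ i → inject≤ i k≤k′) (inject≤-injective k≤k′ k≤k′ _ _)

weakenAVDTotalColoring : ∀ {G k k′} → k ≤ k′ → AVDTotalColoring G k → AVDTotalColoring G k′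
weakenAVDTotalColoring k≤k′ = mapAVDTotalColoring (λ i → inject≤ i k≤k′) (inject≤-injective k≤k′ k≤k′ _ _)

-- An AVD total coloring of a corona

another : ∀ {m} → 2 ≤ m → Fin m → Fin m
another {suc (suc m)} _ h = punchIn h zero
another {suc zero} (s≤s ()) h

another-≢ : ∀ {m} (2≤m : 2 ≤ m) h → another 2≤m h ≢ h
another-≢ {suc (suc m)} _ h = punchInᵢ≢i h zero
another-≢ {suc zero} (s≤s ()) h

adjacent⇒≢ : ∀ G {u v} → G ∋ u ~ v → u ≢ v
adjacent⇒≢ G {u} u~v refl with () ← trans (sym u~v) (adj-irrefl G u)

↑ˡ≢↑ʳ : ∀ {m n′} {i : Fin m} {j : Fin n′} → i ↑ˡ n′ ≢ m ↑ʳ j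
↑ˡ≢↑ʳ {m} {n′} {i} {j} e with () ← trans (sym (splitAt-↑ˡ m i n′)) (trans (cong (splitAt m) e) (splitAt-↑ʳ m n′ j))

splitAt-injective : ∀ m {n′} {x y : Fin (m + n′)} → splitAt m x ≡ splitAt m y → x ≡ y
splitAt-injective m {n′} {x} {y} e =
  trans (sym (join-splitAt m n′ x)) (trans (cong (join m n′) e) (join-splitAt m n′ y))

module CoronaColoring (K H : Graph) {k : ℕ} (avdK : AVDTotalColoring K k) (colH : TotalColoring H k)
                      (2≤nH : 2 ≤ n H) where
  open CoronaCoordinates K H

  colK : TotalColoring K k
  colK = AVDTotalColoring.coloring avdK

  Color : Set
  Color = Fin (k + n H)

  old : Fin k → Color
  old i = i ↑ˡ n H

  new : Fin (n H) → Color
  new h = k ↑ʳ h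

  old-injective : ∀ {i j} → old i ≡ old j → i ≡ j
  old-injective = ↑ˡ-injective (n H) _ _

  new-injective : ∀ {h h′} → new h ≡ new h′ → h ≡ h′
  new-injective = ↑ʳ-injective k _ _

  old≢new : ∀ {i h} → old i ≢ new h
  old≢new = ↑ˡ≢↑ʳ

  new≢old : ∀ {i h} → new h ≢ old i
  new≢old = old≢new ∘ sym

  other : Fin (n H) → Fin (n H)
  other = another 2≤nH

  -- On a clash, new (other h) rather than new h, which is the color of the edge to a.
  leafColor : Fin (n K) → Fin (n H) → Color
  leafColor a h with vcol colH h ≟ vcol colK a
  ... | yes _ = new (other h)
  ... | no _  = old (vcol colH h)

  data LeafColorView (a : Fin (n K)) (h : Fin (n H)) : Color → Set where
    clash : vcol colH h ≡ vcol colK a → LeafColorView a h (new (other h))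
    keep  : vcol colH h ≢ vcol colK a → LeafColorView a h (old (vcol colH h))

  leafColor-view : ∀ a h → LeafColorView a h (leafColor a h)
  leafColor-view a h with vcol colH h ≟ vcol colK a
  ... | yes e = clash e
  ... | no ¬e = keep ¬e

  leafColor-clash : ∀ {a h} → vcol colH h ≡ vcol colK a → leafColor a h ≡ new (other h)
  leafColor-clash {a} {h} e with leafColor a h | leafColor-view a h
  ... | _ | clash _ = refl
  ... | _ | keep ¬e = ⊥-elim (¬e e)

  leafColor-keep : ∀ {a h} → vcol colH h ≢ vcol colK a → leafColor a h ≡ old (vcol colH h)
  leafColor-keep {a} {h} ¬e with leafColor a h | leafColor-view a h
  ... | _ | clash e = ⊥-elim (¬e e)
  ... | _ | keep _  = refl

  vertexColor : Vertex → Color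
  vertexColor (inj₁ a) = old (vcol colK a)
  vertexColor (inj₂ p) = leafColor (block p) (position p)

  edgeColor : Vertex → Vertex → Color
  edgeColor (inj₁ a) (inj₁ b) = old (ecol colK a b)
  edgeColor (inj₁ a) (inj₂ p) = new (position p)
  edgeColor (inj₂ p) (inj₁ a) = new (position p)
  edgeColor (inj₂ p) (inj₂ q) = old (ecol colH (position p) (position q))

  _~_ : Vertex → Vertex → Set
  x ~ y = adjacent x y ≡ true

  base~leaf : ∀ {a p} → inj₁ a ~ inj₂ p → a ≡ block p
  base~leaf = ≟-sound

  leaf~leaf : ∀ {p q} → inj₂ p ~ inj₂ q → block p ≡ block q × H ∋ position p ~ position q
  leaf~leaf {p} {q} e = ≟-sound (∧-conicalˡ _ _ e) , ∧-conicalʳ _ _ e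

  leaf-injective : ∀ {p q} → block p ≡ block q → position p ≡ position q → p ≡ q
  leaf-injective {p} {q} e e′ =
    trans (sym (combine-remQuot {n K} (n H) p)) (trans (cong₂ combine e e′) (combine-remQuot {n K} (n H) q))

  edgeColor-sym : ∀ x y → x ~ y → edgeColor x y ≡ edgeColor y x
  edgeColor-sym (inj₁ a) (inj₁ b) a~b = cong old (ecol-sym colK a b a~b)
  edgeColor-sym (inj₁ a) (inj₂ p) _   = refl
  edgeColor-sym (inj₂ p) (inj₁ a) _   = refl
  edgeColor-sym (inj₂ p) (inj₂ q) p~q = cong old (ecol-sym colH _ _ (proj₂ (leaf~leaf p~q)))

  leafColor-proper : ∀ a h h′ → H ∋ h ~ h′ → leafColor a h ≢ leafColor a h′
  leafColor-proper a h h′ h~h′ with leafColor a h | leafColor-view a h | leafColor a h′ | leafColor-view a h′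
  ... | _ | clash e | _ | clash e′ = λ _ → vv colH h h′ h~h′ (trans e (sym e′))
  ... | _ | clash _ | _ | keep _   = new≢old
  ... | _ | keep _  | _ | clash _  = old≢new
  ... | _ | keep _  | _ | keep _   = vv colH h h′ h~h′ ∘ old-injective

  leafColor≢base : ∀ a h → leafColor a h ≢ old (vcol colK a)
  leafColor≢base a h with leafColor a h | leafColor-view a h
  ... | _ | clash _  = new≢old
  ... | _ | keep ¬e  = ¬e ∘ old-injective

  vertexColor-proper : ∀ x y → x ~ y → vertexColor x ≢ vertexColor y
  vertexColor-proper (inj₁ a) (inj₁ b) a~b = vv colK a b a~b ∘ old-injective
  vertexColor-proper (inj₁ a) (inj₂ p) a~p rewrite base~leaf a~p = leafColor≢base _ _ ∘ sym
  vertexColor-proper (inj₂ p) (inj₁ a) a~p rewrite base~leaf a~p = leafColor≢base _ _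
  vertexColor-proper (inj₂ p) (inj₂ q) p~q with leaf~leaf p~q
  ... | same-block , h~h′ rewrite same-block = leafColor-proper _ _ _ h~h′

  edgeColor-proper : ∀ x y z → x ~ y → x ~ z → y ≢ z → edgeColor x y ≢ edgeColor x z
  edgeColor-proper (inj₁ a) (inj₁ b) (inj₁ c) a~b a~c b≢c = ee colK a b c a~b a~c (b≢c ∘ cong inj₁) ∘ old-injective
  edgeColor-proper (inj₁ a) (inj₁ b) (inj₂ q) _ _ _ = old≢new
  edgeColor-proper (inj₁ a) (inj₂ p) (inj₁ c) _ _ _ = new≢old
  edgeColor-proper (inj₁ a) (inj₂ p) (inj₂ q) a~p a~q p≢q =
    p≢q ∘ cong inj₂ ∘ leaf-injective (trans (sym (base~leaf a~p)) (base~leaf a~q)) ∘ new-injective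
  edgeColor-proper (inj₂ p) (inj₁ b) (inj₁ c) b~p c~p b≢c _ =
    b≢c (cong inj₁ (trans (base~leaf b~p) (sym (base~leaf c~p))))
  edgeColor-proper (inj₂ p) (inj₁ b) (inj₂ r) _ _ _ = new≢old
  edgeColor-proper (inj₂ p) (inj₂ q) (inj₁ c) _ _ _ = old≢new
  edgeColor-proper (inj₂ p) (inj₂ q) (inj₂ r) p~q p~r q≢r with leaf~leaf p~q | leaf~leaf p~r
  ... | pq , h~hq | pr , h~hr =
    ee colH _ _ _ h~hq h~hr (q≢r ∘ cong inj₂ ∘ leaf-injective (trans (sym pq) pr)) ∘ old-injective

  edgeColor≢leafColor : ∀ a h i → i ≢ vcol colH h → old i ≢ leafColor a h
  edgeColor≢leafColor a h i i≢ with leafColor a h | leafColor-view a h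
  ... | _ | clash _ = old≢new
  ... | _ | keep _  = i≢ ∘ old-injective

  pendantColor≢leafColor : ∀ a h → new h ≢ leafColor a h
  pendantColor≢leafColor a h with leafColor a h | leafColor-view a h
  ... | _ | clash _ = another-≢ 2≤nH h ∘ sym ∘ new-injective
  ... | _ | keep _  = new≢old

  edgeColor≢vertexColor : ∀ x y → x ~ y → edgeColor x y ≢ vertexColor x × edgeColor x y ≢ vertexColor y
  edgeColor≢vertexColor (inj₁ a) (inj₁ b) a~b =
    proj₁ (ve colK a b a~b) ∘ old-injective , proj₂ (ve colK a b a~b) ∘ old-injective
  edgeColor≢vertexColor (inj₁ a) (inj₂ p) _ = new≢old , pendantColor≢leafColor _ _
  edgeColor≢vertexColor (inj₂ p) (inj₁ a) _ = pendantColor≢leafColor _ _ , new≢old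
  edgeColor≢vertexColor (inj₂ p) (inj₂ q) p~q with leaf~leaf p~q
  ... | _ , h~h′ = edgeColor≢leafColor _ _ _ (proj₁ (ve colH _ _ h~h′)) ,
                   edgeColor≢leafColor _ _ _ (proj₂ (ve colH _ _ h~h′))

  _∈C_ : Color → Vertex → Set
  i ∈C x = (vertexColor x ≡ i) ⊎ ∃ λ y → x ~ y × edgeColor x y ≡ i

  record SameColors (x y : Vertex) : Set where
    field
      to   : ∀ {i} → i ∈C x → i ∈C y
      from : ∀ {i} → i ∈C y → i ∈C x

  open SameColors

  separated : ∀ {x y i} → i ∈C x → ¬ i ∈C y → ¬ SameColors x y
  separated i∈x i∉y same = i∉y (to same i∈x)

  SameColors-sym : ∀ {x y} → SameColors x y → SameColors y x
  SameColors-sym same = record { to = from same ; from = to same }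

  base-old⁺ : ∀ {a i} → i ∈C[ colK ] a → old i ∈C inj₁ a
  base-old⁺ (inj₁ e)             = inj₁ (cong old e)
  base-old⁺ (inj₂ (b , a~b , e)) = inj₂ (inj₁ b , a~b , cong old e)

  base-old⁻ : ∀ {a i} → old i ∈C inj₁ a → i ∈C[ colK ] a
  base-old⁻ (inj₁ e)                 = inj₁ (old-injective e)
  base-old⁻ (inj₂ (inj₁ b , a~b , e)) = inj₂ (b , a~b , old-injective e)
  base-old⁻ (inj₂ (inj₂ p , _ , e))   = ⊥-elim (new≢old e)

  leaf-old⁻ : ∀ {p i} → old i ∈C inj₂ p →
    (leafColor (block p) (position p) ≡ old i) ⊎ ∃ λ h → H ∋ position p ~ h × ecol colH (position p) h ≡ i
  leaf-old⁻ (inj₁ e)                 = inj₁ e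
  leaf-old⁻ (inj₂ (inj₁ a , _ , e))   = ⊥-elim (new≢old e)
  leaf-old⁻ (inj₂ (inj₂ q , p~q , e)) = inj₂ (position q , proj₂ (leaf~leaf p~q) , old-injective e)

  leaf-new⁻ : ∀ {p h} → new h ∈C inj₂ p → (h ≡ position p) ⊎ (leafColor (block p) (position p) ≡ new h)
  leaf-new⁻ (inj₁ e)                = inj₂ e
  leaf-new⁻ (inj₂ (inj₁ a , _ , e)) = inj₁ (sym (new-injective e))
  leaf-new⁻ (inj₂ (inj₂ q , _ , e)) = ⊥-elim (old≢new e)

  pendant∈leaf : ∀ p → new (position p) ∈C inj₂ p
  pendant∈leaf p = inj₂ (inj₁ (block p) , ≟-true refl , refl)

  pendant∈base : ∀ a h → new h ∈C inj₁ a
  pendant∈base a h = inj₂ (inj₂ (combine a h) , ≟-true (sym (block-combine a h)) , cong new (position-combine a h))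

  distinguish-base-leaf : ∀ p → ¬ SameColors (inj₁ (block p)) (inj₂ p)
  distinguish-base-leaf p = by-cases (vcol colH (position p) ≟ vcol colK (block p))
    where
    by-cases : Dec (vcol colH (position p) ≡ vcol colK (block p)) → ¬ SameColors (inj₁ (block p)) (inj₂ p)
    by-cases (yes e) = separated (inj₁ refl) λ m → case leaf-old⁻ m of λ
      { (inj₁ c)            → new≢old (trans (sym (leafColor-clash e)) c)
      ; (inj₂ (h , h~ , c)) → proj₁ (ve colH _ h h~) (trans c (sym e)) }
    by-cases (no ¬e) = separated (pendant∈base (block p) (other (position p))) λ m → case leaf-new⁻ m of λ
      { (inj₁ c) → another-≢ 2≤nH (position p) c
      ; (inj₂ c) → old≢new (trans (sym (leafColor-keep ¬e)) c) }

  distinguish-base-base : ∀ a b → K ∋ a ~ b → ¬ SameColors (inj₁ a) (inj₁ b)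
  distinguish-base-base a b a~b same = AVDTotalColoring.distinguishing avdK a b a~b λ i →
    base-old⁻ ∘ to same ∘ base-old⁺ , base-old⁻ ∘ from same ∘ base-old⁺

  distinguish-leaf-leaf : ∀ p q → block p ≡ block q → H ∋ position p ~ position q → ¬ SameColors (inj₂ p) (inj₂ q)
  distinguish-leaf-leaf p q same-block h~h′ = by-cases (vcol colH (position q) ≟ vcol colK (block q))
    where
    h≢h′ : position p ≢ position q
    h≢h′ = adjacent⇒≢ H h~h′
    by-cases : Dec (vcol colH (position q) ≡ vcol colK (block q)) → ¬ SameColors (inj₂ p) (inj₂ q)
    by-cases (no ¬e) = separated (pendant∈leaf p) λ m → case leaf-new⁻ m of λ
      { (inj₁ c) → h≢h′ c
      ; (inj₂ c) → old≢new (trans (sym (leafColor-keep ¬e)) c) }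
    by-cases (yes e) = separated (pendant∈leaf q) (λ m → case leaf-new⁻ m of λ
      { (inj₁ c) → h≢h′ (sym c)
      ; (inj₂ c) → case vcol colH (position p) ≟ vcol colK (block p) of λ
          { (yes e′) → vv colH _ _ h~h′ (trans e′ (trans (cong (vcol colK) same-block) (sym e)))
          ; (no ¬e′) → old≢new (trans (sym (leafColor-keep ¬e′)) c) } }) ∘ SameColors-sym

  distinguish : ∀ x y → x ~ y → ¬ SameColors x y
  distinguish (inj₁ a) (inj₁ b) a~b = distinguish-base-base a b a~b
  distinguish (inj₁ a) (inj₂ p) a~p rewrite base~leaf a~p = distinguish-base-leaf p
  distinguish (inj₂ p) (inj₁ a) a~p rewrite base~leaf a~p = distinguish-base-leaf p ∘ SameColors-sym
  distinguish (inj₂ p) (inj₂ q) p~q = distinguish-leaf-leaf p q (proj₁ (leaf~leaf p~q)) (proj₂ (leaf~leaf p~q))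

  coords : Fin (n (corona K H)) → Vertex
  coords = splitAt (n K)

  ~-coords : ∀ x y → corona K H ∋ x ~ y → coords x ~ coords y
  ~-coords x y x~y = trans (sym (adj-corona x y)) x~y

  coloring : TotalColoring (corona K H) (k + n H)
  coloring = record
    { vcol     = vertexColor ∘ coords
    ; ecol     = λ x y → edgeColor (coords x) (coords y)
    ; ecol-sym = λ x y x~y → edgeColor-sym (coords x) (coords y) (~-coords x y x~y)
    ; vv       = λ x y x~y → vertexColor-proper (coords x) (coords y) (~-coords x y x~y)
    ; ee       = λ x y z x~y x~z y≢z → edgeColor-proper (coords x) (coords y) (coords z)
                   (~-coords x y x~y) (~-coords x z x~z) (y≢z ∘ splitAt-injective (n K))
    ; ve       = λ x y x~y → edgeColor≢vertexColor (coords x) (coords y) (~-coords x y x~y)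
    }

  ∈C-coords : ∀ {x i} → i ∈C[ coloring ] x → i ∈C coords x
  ∈C-coords (inj₁ e)             = inj₁ e
  ∈C-coords {x} (inj₂ (y , x~y , e)) = inj₂ (coords y , ~-coords x y x~y , e)

  coords-∈C : ∀ {x i} → i ∈C coords x → i ∈C[ coloring ] x
  coords-∈C (inj₁ e) = inj₁ e
  coords-∈C {x} (inj₂ (t , x~t , e)) =
    inj₂ (join (n K) _ t , trans (adj-corona x _) (subst (λ s → coords x ~ s) (sym t≡) x~t) ,
          trans (cong (edgeColor (coords x)) t≡) e)
    where
    t≡ : coords (join (n K) _ t) ≡ t
    t≡ = splitAt-join (n K) _ t

  avd : AVDTotalColoring (corona K H) (k + n H)
  avd = record
    { coloring       = coloring
    ; distinguishing = λ x y x~y same → distinguish (coords x) (coords y) (~-coords x y x~y) record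
        { to   = λ i∈x → ∈C-coords {y} (proj₁ (same _) (coords-∈C {x} i∈x))
        ; from = λ i∈y → ∈C-coords {x} (proj₂ (same _) (coords-∈C {y} i∈y)) }
    }

lcorona-avd : ∀ G H {k t} → 2 ≤ n H → AVDTotalColoring G k → TotalColoring H t → t ≤ k →
  ∀ l → AVDTotalColoring (lcorona G H l) (k + l * n H)
lcorona-avd G H {k} 2≤nH avdG colH t≤k zero = subst (AVDTotalColoring G) (sym (+-identityʳ k)) avdG
lcorona-avd G H {k} 2≤nH avdG colH t≤k (suc l) =
  subst (AVDTotalColoring (lcorona G H (suc l))) colors
    (CoronaColoring.avd (lcorona G H l) H (lcorona-avd G H 2≤nH avdG colH t≤k l)
      (weakenTotalColoring (≤-trans t≤k (m≤m+n k (l * n H))) colH) 2≤nH)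
  where
  colors : k + l * n H + n H ≡ k + (n H + l * n H)
  colors = trans (+-assoc k (l * n H) (n H)) (cong (k +_) (+-comm (l * n H) (n H)))

χ''a≤-lcorona : ∀ G H c → Fin (n G) → 2 ≤ n H → χ''a≤ G (Δ G + c) → χ''≤ H (Δ G + c) →
  ∀ l → χ''a≤ (lcorona G H l) (Δ (lcorona G H l) + c)
χ''a≤-lcorona G H c v 2≤nH (k , k≤ , avdG) (t , t≤ , colH) l =
  Δ G + c + l * n H ,
  bound ,
  lcorona-avd G H 2≤nH (weakenAVDTotalColoring k≤ avdG) colH t≤ l
  where
  open ≤-Reasoning
  bound : Δ G + c + l * n H ≤ Δ (lcorona G H l) + c
  bound = begin
    Δ G + c + l * n H             ≡⟨ +-assoc (Δ G) c (l * n H) ⟩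
    Δ G + (c + l * n H)           ≡⟨ cong (Δ G +_) (+-comm c (l * n H)) ⟩
    Δ G + (l * n H + c)           ≡⟨ +-assoc (Δ G) (l * n H) c ⟨
    Δ G + l * n H + c             ≤⟨ +-monoˡ-≤ c (Δ-lcorona G H v l) ⟩
    Δ (lcorona G H l) + c         ∎

-- König's edge-coloring theorem, by Kempe chains

record PartialEdgeColoring (G : Graph) (D : ℕ) : Set where
  field
    color           : Fin (n G) → Fin (n G) → Maybe (Fin D)
    color-sym       : ∀ x y → color x y ≡ color y x
    color-adj       : ∀ {x y γ} → color x y ≡ just γ → G ∋ x ~ y
    color-injective : ∀ {x y z γ} → color x y ≡ just γ → color x z ≡ just γ → y ≡ z

open PartialEdgeColoring

module _ {G : Graph} {D : ℕ} where

  Missing : PartialEdgeColoring G D → Fin D → Fin (n G) → Set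
  Missing P γ x = ∀ y → color P x y ≢ just γ

  Colored : PartialEdgeColoring G D → Fin (n G) → Fin (n G) → Set
  Colored P x y = ∃ λ γ → color P x y ≡ just γ

  _⊑_ : PartialEdgeColoring G D → PartialEdgeColoring G D → Set
  P ⊑ P′ = ∀ {x y} → Colored P x y → Colored P′ x y

  -- If all D colors were used at x, their D neighbors and the uncolored neighbor y would give deg x > D.
  missing-color : ∀ (P : PartialEdgeColoring G D) → Δ G ≤ D → ∀ {x y} → G ∋ x ~ y → color P x y ≡ nothing →
    ∃ λ γ → Missing P γ x
  missing-color P Δ≤D {x} {y} x~y uncolored with all? (λ γ → any? (λ z → ≡-dec _≟_ (color P x z) (just γ)))
  ... | no ¬all-used with γ , ¬used ← ¬∀⟶∃¬ D _ (λ γ → any? (λ z → ≡-dec _≟_ (color P x z) (just γ))) ¬all-used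
    = γ , λ z e → ¬used (z , e)
  ... | yes all-used = ⊥-elim (1+n≰n (begin
    suc D               ≤⟨ injective⇒≤count (adj G x) F F-injective F-adjacent ⟩
    count (adj G x)     ≡⟨ deg≡count G x ⟨
    deg G x             ≤⟨ deg≤Δ G x ⟩
    Δ G                 ≤⟨ Δ≤D ⟩
    D                   ∎))
    where
    open ≤-Reasoning
    F : Fin (suc D) → Fin (n G)
    F zero    = y
    F (suc γ) = proj₁ (all-used γ)
    y-uncolored : ∀ {γ} → color P x y ≢ just γ
    y-uncolored e with () ← trans (sym uncolored) e
    F-injective : ∀ {i j} → F i ≡ F j → i ≡ j
    F-injective {zero}  {zero}  _ = refl
    F-injective {zero}  {suc j} e = ⊥-elim (y-uncolored (subst (λ z → color P x z ≡ _) (sym e) (proj₂ (all-used j))))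
    F-injective {suc i} {zero}  e = ⊥-elim (y-uncolored (subst (λ z → color P x z ≡ _) e (proj₂ (all-used i))))
    F-injective {suc i} {suc j} e =
      cong suc (just-injective (trans (sym (proj₂ (all-used i))) (trans (cong (color P x) e) (proj₂ (all-used j)))))
    F-adjacent : ∀ i → adj G x (F i) ≡ true
    F-adjacent zero    = x~y
    F-adjacent (suc γ) = color-adj P (proj₂ (all-used γ))

transpose-matchʳ : ∀ {m} (i j : Fin m) → PC.transpose i j j ≡ i
transpose-matchʳ i j with j ≟ i
... | yes j≡i = j≡i
... | no _ rewrite dec-true (j ≟ j) refl = refl

transpose-≢ : ∀ {m} {i j k : Fin m} → k ≢ i → k ≢ j → PC.transpose i j k ≡ k
transpose-≢ {i = i} {j} {k} k≢i k≢j rewrite dec-false (k ≟ i) k≢i | dec-false (k ≟ j) k≢j = refl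

transpose-injective : ∀ {m} (i j : Fin m) {k l} → PC.transpose i j k ≡ PC.transpose i j l → k ≡ l
transpose-injective i j {k} {l} e =
  trans (sym (PC.transpose-inverse j i)) (trans (cong (PC.transpose j i) e) (PC.transpose-inverse j i))

transpose≡ˡ : ∀ {m} {i j k : Fin m} → PC.transpose i j k ≡ i → k ≡ j
transpose≡ˡ {i = i} {j} {k} e =
  trans (sym (PC.transpose-inverse j i)) (trans (cong (PC.transpose j i) e) (transpose-matchʳ j i))

map≡just : ∀ {A B : Set} {f : A → B} {m b} → Maybe.map f m ≡ just b → ∃ λ a → m ≡ just a
map≡just {m = just a} _ = a , refl

-- S must be closed under α/β-edges so that an edge leaving S keeps its color seen from either end.
module KempeSwap {G : Graph} {D : ℕ} (P : PartialEdgeColoring G D) (α β : Fin D)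
  {S : Fin (n G) → Set} (S? : ∀ x → Dec (S x))
  (S-closed : ∀ {x y γ} → S x → color P x y ≡ just γ → γ ≡ α ⊎ γ ≡ β → S y) where

  swapAt : Fin (n G) → Fin D → Fin D
  swapAt x with S? x
  ... | yes _ = PC.transpose α β
  ... | no _  = id

  swapAt-injective : ∀ x {γ δ} → swapAt x γ ≡ swapAt x δ → γ ≡ δ
  swapAt-injective x with S? x
  ... | yes _ = transpose-injective α β
  ... | no _  = id

  boundary : ∀ {x y} → S x → ¬ S y → Maybe.map (PC.transpose α β) (color P x y) ≡ color P x y
  boundary {x} {y} x∈S y∉S with color P x y in e
  ... | nothing = refl
  ... | just γ  = cong just (transpose-≢ (y∉S ∘ S-closed x∈S e ∘ inj₁) (y∉S ∘ S-closed x∈S e ∘ inj₂))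

  recolor : Fin (n G) → Fin (n G) → Maybe (Fin D)
  recolor x y = Maybe.map (swapAt x) (color P x y)

  recolor-sym : ∀ x y → recolor x y ≡ recolor y x
  recolor-sym x y with S? x | S? y
  ... | yes _   | yes _   = cong (Maybe.map (PC.transpose α β)) (color-sym P x y)
  ... | no _    | no _    = trans (map-id (color P x y)) (trans (color-sym P x y) (sym (map-id _)))
  ... | yes x∈S | no y∉S  = trans (boundary x∈S y∉S) (trans (color-sym P x y) (sym (map-id _)))
  ... | no x∉S  | yes y∈S = trans (map-id _) (trans (color-sym P x y) (sym (boundary y∈S x∉S)))

  swapped : PartialEdgeColoring G D
  swapped = record
    { color           = recolor
    ; color-sym       = recolor-sym
    ; color-adj       = λ e → color-adj P (proj₂ (map≡just e))
    ; color-injective = recolor-injective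
    }
    where
    recolor-injective : ∀ {x y z γ} → recolor x y ≡ just γ → recolor x z ≡ just γ → y ≡ z
    recolor-injective {x} e e′ with map≡just e
    ... | _ , cy = color-injective P cy
      (trans (sym (map-injective (swapAt-injective x) (trans e (sym e′)))) cy)

  P⊑swapped : P ⊑ swapped
  P⊑swapped {x} (γ , e) = swapAt x γ , map-just e

  swapped-outside : ∀ {x} y → ¬ S x → color swapped x y ≡ color P x y
  swapped-outside {x} y x∉S with S? x
  ... | yes x∈S = ⊥-elim (x∉S x∈S)
  ... | no _    = map-id _

  swapped-inside : ∀ {x} y → S x → color swapped x y ≡ Maybe.map (PC.transpose α β) (color P x y)
  swapped-inside {x} y x∈S with S? x
  ... | yes _   = refl
  ... | no x∉S  = ⊥-elim (x∉S x∈S)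

odd : ℕ → Bool
odd zero    = false
odd (suc k) = not (odd k)

xor-cancelʳ : ∀ s {a b} → a xor s ≡ b xor s → a ≡ b
xor-cancelʳ s {false} {false} _ = refl
xor-cancelʳ s {true}  {true}  _ = refl
xor-cancelʳ s {false} {true}  e = ⊥-elim (not-¬ refl e)
xor-cancelʳ s {true}  {false} e = ⊥-elim (not-¬ refl (sym e))

-- The α/β-alternating walk from v starts with α, as β is missing at v. Parity (G is bipartite) keeps u off
-- the walk, so after swapping α and β along it, α is missing at both u and v.
module KempeChain {G : Graph} {D : ℕ} (P : PartialEdgeColoring G D)
  (side : Fin (n G) → Bool) (bipartite : ∀ x y → G ∋ x ~ y → side x ≢ side y)
  (α β : Fin D) {u v : Fin (n G)} (u~v : G ∋ u ~ v) (α∉u : Missing P α u) (β∉v : Missing P β v) where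

  chainColor : ℕ → Fin D
  chainColor k = if odd k then β else α

  next : Fin (n G) → Fin D → Maybe (Fin (n G))
  next x γ with any? (λ y → ≡-dec _≟_ (color P x y) (just γ))
  ... | yes (y , _) = just y
  ... | no _        = nothing

  next-sound : ∀ {x γ y} → next x γ ≡ just y → color P x y ≡ just γ
  next-sound {x} {γ} e with any? (λ y → ≡-dec _≟_ (color P x y) (just γ))
  next-sound refl | yes (_ , c) = c

  next-complete : ∀ {x γ y} → color P x y ≡ just γ → next x γ ≡ just y
  next-complete {x} {γ} c with any? (λ y → ≡-dec _≟_ (color P x y) (just γ))
  ... | yes (_ , c′) = cong just (color-injective P c′ c)
  ... | no none      = ⊥-elim (none (_ , c))

  chain : ℕ → Maybe (Fin (n G))
  chain zero    = just v
  chain (suc k) = chain k >>= λ x → next x (chainColor k)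

  chain-back : ∀ k {y} → chain (suc k) ≡ just y → ∃ λ x → chain k ≡ just x × color P y x ≡ just (chainColor k)
  chain-back k e with chain k
  ... | just x = x , refl , trans (color-sym P _ x) (next-sound e)

  chain-forth : ∀ k {x y} → chain k ≡ just x → color P x y ≡ just (chainColor k) → chain (suc k) ≡ just y
  chain-forth k e c rewrite e = next-complete c

  chain-side : ∀ k {x} → chain k ≡ just x → side x ≡ odd k xor side v
  chain-side zero    refl = refl
  chain-side (suc k) {y} e with chain-back k e
  ... | x , ex , c = begin
    side y                     ≡⟨ ¬-not (bipartite x y (color-adj P (trans (color-sym P x y) c)) ∘ sym) ⟩
    not (side x)               ≡⟨ cong not (chain-side k ex) ⟩
    not (odd k xor side v)     ≡⟨ not-distribˡ-xor (odd k) (side v) ⟩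
    not (odd k) xor side v     ∎
    where open ≡-Reasoning

  same-parity : ∀ i j {x} → chain i ≡ just x → chain j ≡ just x → odd i ≡ odd j
  same-parity i j ei ej = xor-cancelʳ (side v) (trans (sym (chain-side i ei)) (chain-side j ej))

  chainColor-even : ∀ k → odd k ≡ false → chainColor k ≡ α
  chainColor-even k e rewrite e = refl

  chainColor-odd : ∀ k → odd k ≡ true → chainColor k ≡ β
  chainColor-odd k e rewrite e = refl

  chainColor-other : ∀ k {γ} → γ ≡ α ⊎ γ ≡ β → γ ≢ chainColor k → γ ≡ chainColor (suc k)
  chainColor-other k αβ γ≢ with odd k
  chainColor-other k (inj₁ γ≡α) γ≢ | false = ⊥-elim (γ≢ γ≡α)
  chainColor-other k (inj₂ γ≡β) γ≢ | false = γ≡β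
  chainColor-other k (inj₁ γ≡α) γ≢ | true  = γ≡α
  chainColor-other k (inj₂ γ≡β) γ≢ | true  = ⊥-elim (γ≢ γ≡β)

  chainColor-period : ∀ k → chainColor (suc (suc k)) ≡ chainColor k
  chainColor-period k = cong (λ b → if b then β else α) (not-involutive (odd k))

  chain-injective : ∀ i j {x} → i < j → chain i ≡ just x → chain j ≡ just x → ⊥
  chain-injective zero (suc j) _ refl ej with chain-back j ej
  ... | w , _ , c = β∉v w (trans c (cong just (chainColor-odd j (trans (sym (not-involutive (odd j))) (cong not (sym (same-parity 0 (suc j) refl ej)))))))
  chain-injective (suc i) (suc j) (s≤s i<j) ei ej with chain-back i ei | chain-back j ej
  ... | a , ea , ca | b , eb , cb = chain-injective i j i<j ea (subst (λ z → chain j ≡ just z) (sym a≡b) eb)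
    where
    a≡b : a ≡ b
    a≡b = color-injective P ca (trans cb (cong (just ∘ λ t → if t then β else α)
            (not-injective (sym (same-parity (suc i) (suc j) ei ej)))))

  chain-prefix : ∀ {j k y} → j ≤ k → chain k ≡ just y → ∃ λ x → chain j ≡ just x
  chain-prefix {k = k} j≤k e with m≤n⇒m<n∨m≡n j≤k
  ... | inj₂ refl = _ , e
  chain-prefix {k = suc k} _ e | inj₁ (s≤s j≤k) = chain-prefix j≤k (proj₁ (proj₂ (chain-back k e)))

  chain-length : ∀ k {y} → chain k ≡ just y → k < n G
  chain-length k e = injective⇒≤ F-injective
    where
    F : Fin (suc k) → Fin (n G)
    F i = proj₁ (chain-prefix (s≤s⁻¹ (toℕ<n i)) e)
    F-chain : ∀ i → chain (toℕ i) ≡ just (F i)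
    F-chain i = proj₂ (chain-prefix (s≤s⁻¹ (toℕ<n i)) e)
    F-injective : ∀ {i j} → F i ≡ F j → i ≡ j
    F-injective {i} {j} Fi≡Fj with <-cmp (toℕ i) (toℕ j)
    ... | tri< i<j _ _ = ⊥-elim (chain-injective _ _ i<j (F-chain i) (trans (F-chain j) (cong just (sym Fi≡Fj))))
    ... | tri≈ _ i≡j _ = toℕ-injective i≡j
    ... | tri> _ _ j<i = ⊥-elim (chain-injective _ _ j<i (F-chain j) (trans (F-chain i) (cong just Fi≡Fj)))

  OnChain : Fin (n G) → Set
  OnChain x = ∃ λ (i : Fin (n G)) → chain (toℕ i) ≡ just x

  onChain? : ∀ x → Dec (OnChain x)
  onChain? x = any? λ i → ≡-dec _≟_ (chain (toℕ i)) (just x)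

  onChain : ∀ k {x} → chain k ≡ just x → OnChain x
  onChain k e = fromℕ< (chain-length k e) , trans (cong chain (toℕ-fromℕ< (chain-length k e))) e

  chain-closed : ∀ {x y γ} → OnChain x → color P x y ≡ just γ → γ ≡ α ⊎ γ ≡ β → OnChain y
  chain-closed (i , ex) = closed (toℕ i) ex
    where
    closed : ∀ k {x y γ} → chain k ≡ just x → color P x y ≡ just γ → γ ≡ α ⊎ γ ≡ β → OnChain y
    closed k {γ = γ} ex c αβ with γ ≟ chainColor k
    ... | yes refl = onChain (suc k) (chain-forth k ex c)
    closed zero    refl c αβ | no γ≢ = ⊥-elim (β∉v _ (trans c (cong just (chainColor-other 0 αβ γ≢))))
    closed (suc k) ex c αβ | no γ≢ with chain-back k ex
    ... | a , ea , ca = onChain k (trans ea (cong just (color-injective P ca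
            (trans c (cong just (trans (chainColor-other (suc k) αβ γ≢) (chainColor-period k)))))))

  u∉chain : ¬ OnChain u
  u∉chain (i , e) = off (toℕ i) e
    where
    off : ∀ k → chain k ≡ just u → ⊥
    off zero    e = adjacent⇒≢ G u~v (sym (just-injective e))
    off (suc k) e with chain-back k e | odd k in parity
    ... | a , _ , c | false = α∉u a (trans c (cong just (chainColor-even k parity)))
    ... | _         | true  = bipartite u v u~v (trans (chain-side (suc k) e) (cong (λ b → not b xor side v) parity))

  open KempeSwap P α β onChain? chain-closed public

  α∉u-swapped : Missing swapped α u
  α∉u-swapped y e = α∉u y (trans (sym (swapped-outside y u∉chain)) e)

  α∉v-swapped : Missing swapped α v
  α∉v-swapped y e with map≡just (trans (sym (swapped-inside y (onChain 0 refl))) e)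
  ... | δ , c = β∉v y (trans c (cong just (transpose≡ˡ (just-injective
                  (trans (sym (map-just c)) (trans (sym (swapped-inside y (onChain 0 refl))) e))))))

module ColorEdge {G : Graph} {D : ℕ} (P : PartialEdgeColoring G D) {u v : Fin (n G)} (u~v : G ∋ u ~ v)
  (γ : Fin D) (γ∉u : Missing P γ u) (γ∉v : Missing P γ v) where

  IsUV : Fin (n G) → Fin (n G) → Set
  IsUV x y = (x ≡ u × y ≡ v) ⊎ (x ≡ v × y ≡ u)

  isUV? : ∀ x y → Dec (IsUV x y)
  isUV? x y = (x ≟ u ×-dec y ≟ v) ⊎-dec (x ≟ v ×-dec y ≟ u)

  IsUV-sym : ∀ {x y} → IsUV x y → IsUV y x
  IsUV-sym (inj₁ (x≡u , y≡v)) = inj₂ (y≡v , x≡u)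
  IsUV-sym (inj₂ (x≡v , y≡u)) = inj₁ (y≡u , x≡v)

  IsUV-missing : ∀ {x y} → IsUV x y → Missing P γ x
  IsUV-missing (inj₁ (refl , _)) = γ∉u
  IsUV-missing (inj₂ (refl , _)) = γ∉v

  IsUV-unique : ∀ {x y z} → IsUV x y → IsUV x z → y ≡ z
  IsUV-unique (inj₁ (_ , refl))    (inj₁ (_ , refl))    = refl
  IsUV-unique (inj₂ (_ , refl))    (inj₂ (_ , refl))    = refl
  IsUV-unique (inj₁ (x≡u , _))     (inj₂ (x≡v , _))     = ⊥-elim (adjacent⇒≢ G u~v (trans (sym x≡u) x≡v))
  IsUV-unique (inj₂ (x≡v , _))     (inj₁ (x≡u , _))     = ⊥-elim (adjacent⇒≢ G u~v (trans (sym x≡u) x≡v))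

  IsUV-adjacent : ∀ {x y} → IsUV x y → G ∋ x ~ y
  IsUV-adjacent (inj₁ (refl , refl)) = u~v
  IsUV-adjacent (inj₂ (refl , refl)) = trans (adj-sym G v u) u~v

  color′ : Fin (n G) → Fin (n G) → Maybe (Fin D)
  color′ x y with isUV? x y
  ... | yes _ = just γ
  ... | no _  = color P x y

  color′-uv : ∀ {x y} → IsUV x y → color′ x y ≡ just γ
  color′-uv {x} {y} uv with isUV? x y
  ... | yes _  = refl
  ... | no ¬uv = ⊥-elim (¬uv uv)

  color′-other : ∀ {x y} → ¬ IsUV x y → color′ x y ≡ color P x y
  color′-other {x} {y} ¬uv with isUV? x y
  ... | yes uv = ⊥-elim (¬uv uv)
  ... | no _   = refl

  color′-sym : ∀ x y → color′ x y ≡ color′ y x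
  color′-sym x y with isUV? x y
  ... | yes uv  = sym (color′-uv (IsUV-sym uv))
  ... | no ¬uv  = trans (color-sym P x y) (sym (color′-other (¬uv ∘ IsUV-sym)))

  color′-adj : ∀ {x y δ} → color′ x y ≡ just δ → G ∋ x ~ y
  color′-adj {x} {y} e with isUV? x y
  ... | yes uv = IsUV-adjacent uv
  ... | no _   = color-adj P e

  color′-injective : ∀ {x y z δ} → color′ x y ≡ just δ → color′ x z ≡ just δ → y ≡ z
  color′-injective {x} {y} {z} ey ez with isUV? x y | isUV? x z
  ... | yes uv  | yes uv′ = IsUV-unique uv uv′
  ... | yes uv  | no _    = ⊥-elim (IsUV-missing uv z (trans ez (sym ey)))
  ... | no _    | yes uv′ = ⊥-elim (IsUV-missing uv′ y (trans ey (sym ez)))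
  ... | no _    | no _    = color-injective P ey ez

  extended : PartialEdgeColoring G D
  extended = record
    { color           = color′
    ; color-sym       = color′-sym
    ; color-adj       = color′-adj
    ; color-injective = λ {x} {y} {z} → color′-injective {x} {y} {z}
    }

  P⊑extended : P ⊑ extended
  P⊑extended {x} {y} (δ , e) with isUV? x y
  ... | yes _ = γ , refl
  ... | no _  = δ , e

  uv-colored : Colored extended u v
  uv-colored = γ , color′-uv (inj₁ (refl , refl))

module BipartiteEdgeColoring (G : Graph) (side : Fin (n G) → Bool) (bipartite : ∀ x y → G ∋ x ~ y → side x ≢ side y)
  {D : ℕ} (Δ≤D : Δ G ≤ D) where

  color-edge : ∀ (P : PartialEdgeColoring G D) {u v} → G ∋ u ~ v → ∃ λ P′ → P ⊑ P′ × Colored P′ u v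
  color-edge P {u} {v} u~v with color P u v in e
  ... | just γ  = P , id , γ , e
  ... | nothing with missing-color P Δ≤D u~v e | missing-color P Δ≤D (trans (adj-sym G v u) u~v) (trans (color-sym P v u) e)
  ...   | α , α∉u | β , β∉v =
    extended , (λ c → P⊑extended (P⊑swapped c)) , uv-colored
    where
    open KempeChain P side bipartite α β u~v α∉u β∉v
    open ColorEdge swapped u~v α α∉u-swapped α∉v-swapped

  color-pair : ∀ (P : PartialEdgeColoring G D) x y → ∃ λ P′ → P ⊑ P′ × (G ∋ x ~ y → Colored P′ x y)
  color-pair P x y with adj G x y in e
  ... | true  = let (P′ , P⊑P′ , c) = color-edge P e in P′ , P⊑P′ , λ _ → c
  ... | false = P , id , λ ()

  color-pairs : ∀ (L : List (Fin (n G) × Fin (n G))) (P : PartialEdgeColoring G D) →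
    ∃ λ P′ → P ⊑ P′ × (∀ {x y} → (x , y) ∈ L → G ∋ x ~ y → Colored P′ x y)
  color-pairs []             P = P , id , λ ()
  color-pairs ((x , y) ∷ L) P with color-pair P x y
  ... | P₁ , P⊑P₁ , xy with color-pairs L P₁
  ...   | P₂ , P₁⊑P₂ , rest = P₂ , (λ c → P₁⊑P₂ (P⊑P₁ c)) , λ
          { (here refl) x~y → P₁⊑P₂ (xy x~y)
          ; (there m)   x~y → rest m x~y }

  uncolored : PartialEdgeColoring G D
  uncolored = record
    { color = λ _ _ → nothing ; color-sym = λ _ _ → refl ; color-adj = λ () ; color-injective = λ () }

  edge-coloring : ∃ λ (P : PartialEdgeColoring G D) → ∀ {x y} → G ∋ x ~ y → Colored P x y
  edge-coloring with color-pairs (cartesianProduct (allFin (n G)) (allFin (n G))) uncolored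
  ... | P , _ , colored = P , λ {x} {y} → colored (∈-cartesianProduct⁺ (∈-allFin x) (∈-allFin y))

-- Bipartite graphs and the corollary

bipartite-avd : ∀ G → Bipartite G → AVDTotalColoring G (Δ G + 2)
bipartite-avd G (side , bipartite) = record { coloring = coloring ; distinguishing = distinguishing }
  where
  open BipartiteEdgeColoring G side bipartite (≤-refl {Δ G})
  P = proj₁ edge-coloring

  -- only non-edges are uncolored, so the default color is never used
  edgeColor : Fin (n G) → Fin (n G) → Fin (Δ G + 2)
  edgeColor x y = Maybe.maybe′ (_↑ˡ 2) (Δ G ↑ʳ zero) (color P x y)

  edgeColor-edge : ∀ {x y} → G ∋ x ~ y → ∃ λ γ → color P x y ≡ just γ × edgeColor x y ≡ γ ↑ˡ 2
  edgeColor-edge x~y with proj₂ edge-coloring x~y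
  ... | γ , e = γ , e , cong (Maybe.maybe′ (_↑ˡ 2) (Δ G ↑ʳ zero)) e

  sideColor : Bool → Fin (Δ G + 2)
  sideColor b = Δ G ↑ʳ (if b then zero else suc zero)

  sideColor-injective : ∀ {a b} → sideColor a ≡ sideColor b → a ≡ b
  sideColor-injective {false} {false} _ = refl
  sideColor-injective {true}  {true}  _ = refl
  sideColor-injective {false} {true}  e with () ← ↑ʳ-injective (Δ G) _ _ e
  sideColor-injective {true}  {false} e with () ← ↑ʳ-injective (Δ G) _ _ e

  edgeColor≢sideColor : ∀ {x y} → G ∋ x ~ y → ∀ b → edgeColor x y ≢ sideColor b
  edgeColor≢sideColor x~y b e with edgeColor-edge x~y
  ... | γ , _ , e′ = ↑ˡ≢↑ʳ (trans (sym e′) e)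

  coloring : TotalColoring G (Δ G + 2)
  coloring = record
    { vcol     = sideColor ∘ side
    ; ecol     = edgeColor
    ; ecol-sym = λ x y _ → cong (Maybe.maybe′ (_↑ˡ 2) (Δ G ↑ʳ zero)) (color-sym P x y)
    ; vv       = λ x y x~y → bipartite x y x~y ∘ sideColor-injective
    ; ee       = λ x y z x~y x~z y≢z e → case edgeColor-edge x~y , edgeColor-edge x~z of λ
        { ((γ , cy , ey) , (δ , cz , ez)) → y≢z (color-injective P cy
            (trans cz (cong just (sym (↑ˡ-injective 2 γ δ (trans (sym ey) (trans e ez))))))) }
    ; ve       = λ x y x~y → edgeColor≢sideColor x~y (side x) , edgeColor≢sideColor x~y (side y)
    }

  distinguishing : ∀ x y → G ∋ x ~ y →
    ¬ (∀ i → (i ∈C[ coloring ] x → i ∈C[ coloring ] y) × (i ∈C[ coloring ] y → i ∈C[ coloring ] x))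
  distinguishing x y x~y same with proj₁ (same (sideColor (side x))) (inj₁ refl)
  ... | inj₁ e             = bipartite x y x~y (sideColor-injective (sym e))
  ... | inj₂ (z , y~z , e) = edgeColor≢sideColor y~z (side x) e

χ''≤-mono : ∀ {G k k′} → k ≤ k′ → χ''≤ G k → χ''≤ G k′
χ''≤-mono k≤k′ (t , t≤k , col) = t , ≤-trans t≤k k≤k′ , col

χ''a≤⇒χ''≤ : ∀ {G k} → χ''a≤ G k → χ''≤ G k
χ''a≤⇒χ''≤ (t , t≤k , avd) = t , t≤k , AVDTotalColoring.coloring avd

bipartite-χ''a≤ : ∀ G → Bipartite G → χ''a≤ G (Δ G + 2)
bipartite-χ''a≤ G bip = Δ G + 2 , ≤-refl , bipartite-avd G bip

corollary3 : (G H : Graph) → Connected G → Connected H →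
    2 ≤ n G → 2 ≤ n H → Δ H ≤ Δ G → (l : ℕ) → 2 ≤ l →
      ((χ''a≤ G (Δ G + 3) → χ''≤ H (Δ H + 2) →
          χ''a≤ (lcorona G H l) (Δ (lcorona G H l) + 3))
      × (χ''a≤ G (Δ G + 3) → χ''a≤ H (Δ H + 3) →
          χ''a≤ (lcorona G H l) (Δ (lcorona G H l) + 3))
      × (Bipartite G → Bipartite H →
          χ''a≤ (lcorona G H l) (Δ (lcorona G H l) + 2)))
corollary3 G H _ _ 2≤nG 2≤nH ΔH≤ΔG l _ =
    (λ χaG χH → χ''a≤-lcorona G H 3 v 2≤nH χaG (χ''≤-mono (+-mono-≤ ΔH≤ΔG (n≤1+n 2)) χH) l)
  , (λ χaG χaH → χ''a≤-lcorona G H 3 v 2≤nH χaG (χ''≤-mono (+-monoˡ-≤ 3 ΔH≤ΔG) (χ''a≤⇒χ''≤ χaH)) l)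
  , (λ bipG bipH → χ''a≤-lcorona G H 2 v 2≤nH (bipartite-χ''a≤ G bipG)
                     (χ''≤-mono (+-monoˡ-≤ 2 ΔH≤ΔG) (χ''a≤⇒χ''≤ (bipartite-χ''a≤ H bipH))) l)
  where
  v : Fin (n G)
  v = fromℕ< (≤-trans (s≤s z≤n) 2≤nG)
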